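{- Let $k\geq 1$ be an integer and let $\boldsymbol{S}$ be a set of integer lattice points in the plane such that any two distinct elements of $\boldsymbol{S}$ are $k$-visible to each other. Then $\#\boldsymbol{S}\le 2^{k+1}$.
   Context: For a positive integer $k$ and integer lattice points $(u,v),(m,n)$ with $m\neq u$, let $r\in\mathbb{Q}$ be given by $n-v=r(m-u)^k$ and let $\mathcal{C}$ be the curve $y-v=r(x-u)^k$. The point $(m,n)$ is $k$-visible to $(u,v)$ if there is no integer lattice point on the segment of $\mathcal{C}$ strictly between $(u,v)$ and $(m,n)$ (i.e. no integer point $(x,y)$ on $\mathcal{C}$ with $x$ strictly between $u$ and $m$); the curve is only defined when $m\neq u$, and pairs with $m=u$ are not regarded as $k$-visible. This relation is symmetric. -}

module Defs where

open import Data.Nat using (ℕ)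
open import Data.Integer using (ℤ; _+_; _-_; _*_; _^_; _<_)
open import Data.Product using (_×_; _,_)
open import Data.Sum using (_⊎_)
open import Data.Empty using (⊥)
open import Relation.Binary.PropositionalEquality using (_≡_; _≢_)

Point : Set
Point = ℤ × ℤ

StrictlyBetween : ℤ → ℤ → ℤ → Set
StrictlyBetween u x m = (u < x × x < m) ⊎ (m < x × x < u)

-- (x , y) lies on the curve  y - v = r (x - u)^k  with  r = (n - v) / (m - u)^k
-- (m ≠ u); multiplying out the nonzero denominator (m - u)^k.
OnCurve : ℕ → Point → Point → Point → Set
OnCurve k (u , v) (m , n) (x , y) = (y - v) * (m - u) ^ k ≡ (n - v) * (x - u) ^ k

KVisible : ℕ → Point → Point → Set
KVisible k (u , v) (m , n) =
  (m ≢ u) ×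
  (∀ x y → StrictlyBetween u x m → OnCurve k (u , v) (m , n) (x , y) → ⊥)

module Submission where

-- Sort lattice points into 2·2^k classes by the residue of the
-- x-coordinate modulo 2 and of the y-coordinate modulo 2^k.  Two distinct
-- points (u , v), (m , n) in the same class can be written as
-- m = u + 2t and n = v + 2^k s, and then the lattice point (u + t , v + s)
-- lies on the curve  y - v = r (x - u)^k  through them, strictly between
-- them (t ≠ 0 because m ≠ u is part of visibility).  So mutually k-visible
-- points lie in pairwise different classes, and the pigeonhole principle
-- bounds their number by 2·2^k = 2^(k+1).

open import Defs
open import Data.Nat using (ℕ; _≤_; _≥_; _^_; _+_)
open import Data.List using (List; length)
open import Data.List.Relation.Unary.All using (All)
open import Data.List.Relation.Unary.Unique.Propositional using (Unique)
open import Relation.Binary.PropositionalEquality using (_≢_)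

import Data.Nat as ℕ
import Data.Nat.Properties as ℕ
open import Data.Integer as ℤ using (ℤ; +_; 0ℤ; _-_; _<_; _%ℕ_; _/ℕ_)
import Data.Integer.Properties as ℤ
open import Data.Integer.DivMod using (a≡a%ℕn+[a/ℕn]*n; n%ℕd<d)
open import Data.Integer.Solver using (module +-*-Solver)
open import Data.Fin using (Fin; zero; suc; toℕ; fromℕ<; combine) renaming (_<_ to _<ᶠ_)
import Data.Fin.Properties as Fin
import Data.List as List
import Data.List.Relation.Unary.All as All
open import Data.List.Relation.Unary.AllPairs using (_∷_)
open import Data.List.Membership.Propositional.Properties using (∈-lookup)
open import Data.Product using (_,_; proj₁; proj₂)
open import Data.Sum using (inj₁; inj₂)
open import Data.Empty using (⊥-elim)
open import Relation.Nullary using (¬_)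
open import Relation.Binary using (tri<; tri≈; tri>)
open import Relation.Binary.PropositionalEquality
  using (_≡_; refl; sym; trans; cong; cong₂; subst; subst₂; module ≡-Reasoning)

open +-*-Solver

^-distribʳ-* : ∀ (a b : ℤ) k → (a ℤ.* b) ℤ.^ k ≡ a ℤ.^ k ℤ.* b ℤ.^ k
^-distribʳ-* a b ℕ.zero    = refl
^-distribʳ-* a b (ℕ.suc k) = begin
  (a ℤ.* b) ℤ.* (a ℤ.* b) ℤ.^ k            ≡⟨ cong ((a ℤ.* b) ℤ.*_) (^-distribʳ-* a b k) ⟩
  (a ℤ.* b) ℤ.* (a ℤ.^ k ℤ.* b ℤ.^ k)
    ≡⟨ solve 4 (λ a b x y → (a :* b) :* (x :* y) := (a :* x) :* (b :* y)) refl
         a b (a ℤ.^ k) (b ℤ.^ k) ⟩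
  (a ℤ.* a ℤ.^ k) ℤ.* (b ℤ.* b ℤ.^ k)      ∎
  where open ≡-Reasoning

pos-^ : ∀ a k → + (a ^ k) ≡ (+ a) ℤ.^ k
pos-^ a ℕ.zero    = refl
pos-^ a (ℕ.suc k) = trans (ℤ.pos-* a (a ^ k)) (cong ((+ a) ℤ.*_) (pos-^ a k))

-- Scaling the horizontal offset by d and the vertical offset by d^k keeps the
-- unscaled point on the curve: (u + t , v + s) lies on the curve from
-- (u , v) to (u + t·d , v + s·d^k), since s·(t·d)^k = (s·d^k)·t^k.
onCurve-scaled : ∀ k u v t s d →
  OnCurve k (u , v) (u ℤ.+ t ℤ.* d , v ℤ.+ s ℤ.* d ℤ.^ k) (u ℤ.+ t , v ℤ.+ s)
onCurve-scaled k u v t s d = begin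
  (v ℤ.+ s - v) ℤ.* (u ℤ.+ t ℤ.* d - u) ℤ.^ k
    ≡⟨ cong₂ (λ a b → a ℤ.* b ℤ.^ k) (cancel v s) (cancel u (t ℤ.* d)) ⟩
  s ℤ.* (t ℤ.* d) ℤ.^ k                ≡⟨ cong (s ℤ.*_) (^-distribʳ-* t d k) ⟩
  s ℤ.* (t ℤ.^ k ℤ.* d ℤ.^ k)
    ≡⟨ solve 3 (λ s T D → s :* (T :* D) := (s :* D) :* T) refl s (t ℤ.^ k) (d ℤ.^ k) ⟩
  (s ℤ.* d ℤ.^ k) ℤ.* t ℤ.^ k
    ≡⟨ sym (cong₂ (λ a b → a ℤ.* b ℤ.^ k) (cancel v (s ℤ.* d ℤ.^ k)) (cancel u t)) ⟩
  (v ℤ.+ s ℤ.* d ℤ.^ k - v) ℤ.* (u ℤ.+ t - u) ℤ.^ k ∎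
  where
  open ≡-Reasoning
  cancel : ∀ a b → a ℤ.+ b - a ≡ b
  cancel = solve 2 (λ a b → a :+ b :- a := b) refl

<-+-pos : ∀ a t → 0ℤ < t → a < a ℤ.+ t
<-+-pos a t 0<t = subst (_< a ℤ.+ t) (ℤ.+-identityʳ a) (ℤ.+-monoʳ-< a 0<t)

>-+-neg : ∀ a t → t < 0ℤ → a ℤ.+ t < a
>-+-neg a t t<0 = subst (a ℤ.+ t <_) (ℤ.+-identityʳ a) (ℤ.+-monoʳ-< a t<0)

two-steps : ∀ u t → u ℤ.+ t ℤ.+ t ≡ u ℤ.+ t ℤ.* + 2
two-steps = solve 2 (λ u t → (u :+ t) :+ t := u :+ t :* con (+ 2)) refl

midpoint-between : ∀ u t → t ≢ 0ℤ → StrictlyBetween u (u ℤ.+ t) (u ℤ.+ t ℤ.* + 2)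
midpoint-between u t t≢0 with ℤ.<-cmp t 0ℤ
... | tri< t<0 _ _ =
  inj₂ (subst (_< u ℤ.+ t) (two-steps u t) (>-+-neg (u ℤ.+ t) t t<0) , >-+-neg u t t<0)
... | tri≈ _ t≡0 _ = ⊥-elim (t≢0 t≡0)
... | tri> _ _ 0<t =
  inj₁ (<-+-pos u t 0<t , subst (u ℤ.+ t <_) (two-steps u t) (<-+-pos (u ℤ.+ t) t 0<t))

sameResidue⇒offset : ∀ a b d .{{_ : ℕ.NonZero d}} → a %ℕ d ≡ b %ℕ d →
  b ≡ a ℤ.+ (b /ℕ d - a /ℕ d) ℤ.* + d
sameResidue⇒offset a b d eq = begin
  b                                     ≡⟨ a≡a%ℕn+[a/ℕn]*n b d ⟩
  + (b %ℕ d) ℤ.+ (b /ℕ d) ℤ.* + d       ≡⟨ cong (λ r → + r ℤ.+ (b /ℕ d) ℤ.* + d) (sym eq) ⟩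
  + (a %ℕ d) ℤ.+ (b /ℕ d) ℤ.* + d
    ≡⟨ solve 4 (λ r B A D → r :+ B :* D := (r :+ A :* D) :+ (B :- A) :* D) refl
         (+ (a %ℕ d)) (b /ℕ d) (a /ℕ d) (+ d) ⟩
  (+ (a %ℕ d) ℤ.+ (a /ℕ d) ℤ.* + d) ℤ.+ (b /ℕ d - a /ℕ d) ℤ.* + d
    ≡⟨ cong (ℤ._+ (b /ℕ d - a /ℕ d) ℤ.* + d) (sym (a≡a%ℕn+[a/ℕn]*n a d)) ⟩
  a ℤ.+ (b /ℕ d - a /ℕ d) ℤ.* + d       ∎
  where open ≡-Reasoning

residue : ∀ d .{{_ : ℕ.NonZero d}} → ℤ → Fin d
residue d a = fromℕ< (n%ℕd<d a d)

residue-injective : ∀ d .{{_ : ℕ.NonZero d}} a b → residue d a ≡ residue d b → a %ℕ d ≡ b %ℕ d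
residue-injective d a b eq =
  trans (sym (Fin.toℕ-fromℕ< _)) (trans (cong toℕ eq) (Fin.toℕ-fromℕ< _))

module _ (k : ℕ) where

  instance
    2^k≢0 : ℕ.NonZero (2 ^ k)
    2^k≢0 = ℕ.m^n≢0 2 k

  congruent⇒invisible : ∀ u v m n → u %ℕ 2 ≡ m %ℕ 2 → v %ℕ 2 ^ k ≡ n %ℕ 2 ^ k →
    ¬ KVisible k (u , v) (m , n)
  congruent⇒invisible u v m n x≡ y≡ visible = noPoint (u ℤ.+ t) (v ℤ.+ s)
      (midpoint-between u t t≢0) (onCurve-scaled k u v t s (+ 2))
    where
    t = m /ℕ 2 - u /ℕ 2
    s = n /ℕ 2 ^ k - v /ℕ 2 ^ k
    m≡ : m ≡ u ℤ.+ t ℤ.* + 2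
    m≡ = sameResidue⇒offset u m 2 x≡
    n≡ : n ≡ v ℤ.+ s ℤ.* (+ 2) ℤ.^ k
    n≡ = trans (sameResidue⇒offset v n (2 ^ k) y≡) (cong (λ D → v ℤ.+ s ℤ.* D) (pos-^ 2 k))
    noPoint = proj₂ (subst₂ (λ a b → KVisible k (u , v) (a , b)) m≡ n≡ visible)
    t≢0 : t ≢ 0ℤ
    t≢0 t≡0 = proj₁ visible (begin
      m                    ≡⟨ m≡ ⟩
      u ℤ.+ t ℤ.* + 2      ≡⟨ cong (λ z → u ℤ.+ z ℤ.* + 2) t≡0 ⟩
      u ℤ.+ 0ℤ             ≡⟨ ℤ.+-identityʳ u ⟩
      u                    ∎)
      where open ≡-Reasoning

  class : Point → Fin (2 ^ (1 + k))
  class (u , v) = combine (residue 2 u) (residue (2 ^ k) v)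

  sameClass⇒invisible : ∀ p q → class p ≡ class q → ¬ KVisible k p q
  sameClass⇒invisible (u , v) (m , n) eq =
    congruent⇒invisible u v m n (residue-injective 2 u m x≡) (residue-injective (2 ^ k) v n y≡)
    where
    same = Fin.combine-injective (residue 2 u) (residue (2 ^ k) v) (residue 2 m) (residue (2 ^ k) n) eq
    x≡ = proj₁ same
    y≡ = proj₂ same

lookup-distinct : ∀ {A : Set} {xs : List A} → Unique xs →
  ∀ {i j} → i <ᶠ j → List.lookup xs i ≢ List.lookup xs j
lookup-distinct (x∉xs ∷ _) {zero} {suc j} _ = All.lookup x∉xs (∈-lookup j)
lookup-distinct (_ ∷ uniq) {suc i} {suc j} (ℕ.s≤s i<j) = lookup-distinct uniq i<j

pigeonhole-bound : ∀ {A : Set} (S : A → Set) {c} (cls : A → Fin c) →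
  (∀ p q → S p → S q → p ≢ q → cls p ≢ cls q) →
  (xs : List A) → Unique xs → All S xs → length xs ≤ c
pigeonhole-bound S cls separated xs uniq allS = ℕ.≮⇒≥ λ c<len →
  let (i , j , i<j , sameClass) = Fin.pigeonhole c<len (λ i → cls (List.lookup xs i))
  in separated _ _ (All.lookup allS (∈-lookup i)) (All.lookup allS (∈-lookup j))
       (lookup-distinct uniq i<j) sameClass

proposition1 : (k : ℕ) → k ≥ 1 → (S : Point → Set) →
    (∀ p q → S p → S q → p ≢ q → KVisible k p q) →
    (xs : List Point) → Unique xs → All S xs → length xs ≤ 2 ^ (k + 1)
proposition1 k _ S visible xs uniq allS =
  subst (λ e → length xs ≤ 2 ^ e) (ℕ.+-comm 1 k)
    (pigeonhole-bound S (class k) separated xs uniq allS)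
  where
  separated : ∀ p q → S p → S q → p ≢ q → class k p ≢ class k q
  separated p q Sp Sq p≢q same = sameClass⇒invisible k p q same (visible p q Sp Sq p≢q)
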